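{- Let $n\ge 1$ and $w\in S_n$. The support of the dual Schubert polynomial $D^w$ is \[\mathrm{supp}(D^w)=\sum_{(a,b)\in \mathrm{Inv}(w)}\{e_a,e_{a+1},\dots,e_{b-1}\},\] where the right-hand side is the Minkowski sum (in $\mathbb{Z}^{n-1}$) of the sets $\{e_a,e_{a+1},\dots,e_{b-1}\}$ of standard basis vectors, one set for each inversion $(a,b)$ of $w$ (the empty Minkowski sum being $\{0\}$).
   Context: $S_n$ is the symmetric group on $[n]=\{1,\dots,n\}$, permutations written in one-line notation $w=w(1)\cdots w(n)$. An inversion of $w$ is a pair $(a,b)$ with $1\le a<b\le n$ and $w(a)>w(b)$; $\mathrm{Inv}(w)$ is the set of inversions and $\ell(w)=|\mathrm{Inv}(w)|$ is the length. For $a<b$, $wt_{ab}$ denotes the permutation obtained from $w$ by swapping the entries in positions $a$ and $b$. In the (strong) Bruhat order, $u\lessdot v$ (cover) iff $v=ut_{ab}$ for some $a<b$ and $\ell(v)=\ell(u)+1$. The edge $u\lessdot ut_{ab}$ has weight $m(u\lessdot ut_{ab})=x_a+x_{a+1}+\dots+x_{b-1}$, and a saturated chain $C=(u_0\lessdot u_1\lessdot\cdots\lessdot u_\ell)$ has weight $m_C=\prod_{i=1}^{\ell} m(u_{i-1}\lessdot u_i)$. The dual Schubert polynomial is $D^w(x_1,\dots,x_{n-1})=\frac{1}{\ell(w)!}\sum_C m_C$, summed over all saturated chains $C$ from the identity to $w$. The support $\mathrm{supp}(f)$ of a polynomial $f=\sum_\alpha c_\alpha x^\alpha$ is the set of exponent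 vectors $\alpha$ with $c_\alpha\ne 0$; $e_i$ denotes the $i$-th standard basis vector of $\mathbb{Z}^{n-1}$. -}

module Defs where

open import Data.Nat as ℕ using (ℕ; zero; suc; _<ᵇ_)
open import Data.Nat.Properties using (_!≢0)
open import Data.Nat.Base using (_!)
open import Data.Bool using (Bool; true; false; _∧_; if_then_else_)
open import Data.Fin as Fin using (Fin; toℕ)
open import Data.Fin.Permutation using (Permutation′; _⟨$⟩ʳ_)
open import Data.Vec as Vec using (Vec; lookup; _[_]≔_; allFin; tabulate; replicate; zipWith)
open import Data.Vec.Properties using (≡-dec)
open import Data.List as List using (List; []; _∷_; filterᵇ; concatMap; cartesianProduct; length; foldr)
open import Data.List.Membership.Propositional using (_∈_)
open import Data.Product using (_×_; _,_; ∃-syntax; Σ-syntax)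
open import Data.Integer using (+_)
open import Data.Rational as ℚ using (ℚ; 0ℚ; 1ℚ)
open import Relation.Nullary.Decidable using (⌊_⌋)
open import Relation.Nullary using (¬_)
open import Relation.Binary.PropositionalEquality using (_≡_)

-- Permutations in S_n, positions/values 0-indexed (Fin n).
-- One-line notation: the vector w(1) ⋯ w(n).

OneLine : ℕ → Set
OneLine n = Vec (Fin n) n

oneLine : ∀ {n} → Permutation′ n → OneLine n
oneLine w = tabulate (w ⟨$⟩ʳ_)

identity : ∀ {n} → OneLine n
identity {n} = allFin n

Pair : ℕ → Set
Pair n = Fin n × Fin n

pairs : ∀ n → List (Pair n)
pairs n = filterᵇ (λ { (a , b) → toℕ a <ᵇ toℕ b }) (cartesianProduct (Vec.toList (allFin n)) (Vec.toList (allFin n)))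

Inv : ∀ {n} → OneLine n → List (Pair n)
Inv {n} u = filterᵇ (λ { (a , b) → toℕ (lookup u b) <ᵇ toℕ (lookup u a) }) (pairs n)

len : ∀ {n} → OneLine n → ℕ
len u = length (Inv u)

swap : ∀ {n} → OneLine n → Pair n → OneLine n
swap u (a , b) = (u [ a ]≔ lookup u b) [ b ]≔ lookup u a

-- Saturated chains from u: a chain u = u₀ ⋖ u₁ ⋖ ⋯ ⋖ u_k is encoded by the
-- (unique) list of transpositions (a_i , b_i), a_i < b_i, with
-- u_i = u_{i-1} t_{a_i b_i} and ℓ(u_i) = ℓ(u_{i-1}) + 1.

sequences : ∀ {A : Set} → List A → ℕ → List (List A)
sequences xs zero = [] ∷ []
sequences xs (suc k) = concatMap (λ x → List.map (x ∷_) (sequences xs k)) xs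

isSaturated : ∀ {n} → OneLine n → List (Pair n) → Bool
isSaturated u [] = true
isSaturated u ((a , b) ∷ ts) =
  (toℕ a <ᵇ toℕ b) ∧ ⌊ len (swap u (a , b)) ℕ.≟ suc (len u) ⌋ ∧ isSaturated (swap u (a , b)) ts

endpoint : ∀ {n} → OneLine n → List (Pair n) → OneLine n
endpoint u [] = u
endpoint u (t ∷ ts) = endpoint (swap u t) ts

-- all saturated chains from the identity to w (they all have ℓ(w) steps)
chains : ∀ {n} → OneLine n → List (List (Pair n))
chains {n} w = filterᵇ (λ c → isSaturated identity c ∧ ⌊ ≡-dec Fin._≟_ (endpoint identity c) w ⌋)
                       (sequences (pairs n) (len w))

-- Polynomials in x₁ … x_m (m = n - 1) with rational coefficients,
-- represented as formal sums of terms (coefficient , exponent vector).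

Monomial : ℕ → Set
Monomial m = Vec ℕ m

Poly : ℕ → Set
Poly m = List (ℚ × Monomial m)

zeroVec : ∀ {m} → Monomial m
zeroVec {m} = replicate m 0

e : ∀ {m} → Fin m → Monomial m
e i = zeroVec [ i ]≔ 1

onePoly : ∀ {m} → Poly m
onePoly = (1ℚ , zeroVec) ∷ []

_⊗_ : ∀ {m} → Poly m → Poly m → Poly m
p ⊗ q = concatMap (λ { (c , α) → List.map (λ { (d , β) → (c ℚ.* d , zipWith ℕ._+_ α β) }) q }) p

scale : ∀ {m} → ℚ → Poly m → Poly m
scale c = List.map (λ { (d , α) → (c ℚ.* d , α) })

coeff : ∀ {m} → Poly m → Monomial m → ℚ
coeff p α = foldr (λ { (c , β) acc → (if ⌊ ≡-dec ℕ._≟_ β α ⌋ then c else 0ℚ) ℚ.+ acc }) 0ℚ p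

InSupp : ∀ {m} → Poly m → Monomial m → Set
InSupp p α = ¬ (coeff p α ≡ 0ℚ)

-- n = suc m.  Positions a < b in Fin (suc m); variables x_{i+1}, i : Fin m.
-- Edge weight m(u ⋖ u t_ab) = x_a + ⋯ + x_{b-1} (1-indexed), i.e. the
-- 0-indexed variables i with a ≤ i < b.

varsBetween : ∀ {m} → Pair (suc m) → List (Fin m)
varsBetween {m} (a , b) =
  filterᵇ (λ i → (toℕ a ℕ.≤ᵇ toℕ i) ∧ (toℕ i <ᵇ toℕ b)) (Vec.toList (allFin m))

edgeWeight : ∀ {m} → Pair (suc m) → Poly m
edgeWeight t = List.map (λ i → (1ℚ , e i)) (varsBetween t)

chainWeight : ∀ {m} → List (Pair (suc m)) → Poly m
chainWeight c = foldr (λ t acc → edgeWeight t ⊗ acc) onePoly c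

dualSchubert : ∀ {m} → Permutation′ (suc m) → Poly m
dualSchubert w =
  scale (ℚ._/_ (+ 1) (len (oneLine w) !) {{len (oneLine w) !≢0}})
        (concatMap chainWeight (chains (oneLine w)))

MinkowskiSum : ∀ {m} → List (List (Monomial m)) → Monomial m → Set
MinkowskiSum [] α = α ≡ zeroVec
MinkowskiSum (S ∷ Ss) α =
  ∃[ β ] ∃[ γ ] (β ∈ S × MinkowskiSum Ss γ × α ≡ zipWith ℕ._+_ β γ)

basisSegment : ∀ {m} → Pair (suc m) → List (Monomial m)
basisSegment t = List.map e (varsBetween t)

module Submission where

-- Every edge weight x_a + ⋯ + x_{b-1} is a sum of monomials with coefficient one, so D^w has
-- positive coefficients and its support is the union, over saturated chains C from the identity
-- to w, of the Minkowski sums of the segments {e_a, …, e_{b-1}} of the edges (a, b) of C.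
-- Some chain has exactly the inversions of w as its edges: swapping an inversion (a, b) whose
-- values w(b) < w(a) are adjacent lowers the length by one and removes exactly (a, b) from the
-- inversion set. Conversely, along a cover u ⋖ u t_ab the inversions of u inject into those of
-- u t_ab other than (a, b), each onto one with a wider segment; since the cover adds exactly one
-- inversion, this accounts for all inversions of u t_ab, and the Minkowski sum along any chain
-- lies in the one indexed by Inv(w).

open import Defs
open import Data.Nat using (ℕ; zero; suc; _+_; _∸_; _≤_; _<_; _<ᵇ_; _≟_; z≤n; s≤s; _!)
open import Data.List using (map)
open import Data.Fin.Permutation using (Permutation′; _⟨$⟩ʳ_; _⟨$⟩ˡ_; inverseˡ)
open import Function.Bundles using (_⇔_; Equivalence; mk⇔)

open import Algebra.Definitions using (Associative; Commutative)
open import Data.Bool using (Bool; T; _∧_)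
open import Data.Bool.Properties using (T?; T-∧; ∧-assoc)
open import Data.Empty using (⊥; ⊥-elim)
open import Data.Fin as Fin using (Fin; toℕ)
open import Data.Fin.Properties using (toℕ-injective; toℕ<n; toℕ-fromℕ<; any?)
open import Data.Integer using (+_)
open import Data.List as List using (List; []; _∷_; _++_; _∷ʳ_; length; filterᵇ; concatMap)
open import Data.List.Properties using (length-++; length-map; ++-identityʳ)
open import Data.List.Membership.Propositional using (_∈_; _∉_; find)
open import Data.List.Membership.Propositional.Properties
  using (∈-∃++; ∈-filter⁻; ∈-filter⁺; ∈-map⁺; ∈-map⁻; ∈-cartesianProduct⁺; ∈-concatMap⁺; ∈-concatMap⁻)
open import Data.List.Membership.Propositional.Properties.WithK using (unique∧set⇒bag)
open import Data.List.Relation.Binary.BagAndSetEquality using (∼bag⇒↭)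
open import Data.List.Relation.Binary.Permutation.Propositional as ↭
  using (_↭_; ↭-refl; ↭-sym; ↭-trans; ↭-reflexive)
open import Data.List.Relation.Binary.Permutation.Propositional.Properties
  using (shift; ∈-resp-↭; ↭-length; map⁺; ∷↭∷ʳ)
open import Data.List.Relation.Binary.Pointwise using (Pointwise; []; _∷_)
open import Data.List.Relation.Binary.Subset.Propositional using (_⊆_)
open import Data.List.Relation.Unary.All as All using (All; []; _∷_)
open import Data.List.Relation.Unary.Any as Any using (here; there)
open import Data.List.Relation.Unary.Unique.Propositional using (Unique; []; _∷_)
import Data.List.Relation.Unary.Unique.Propositional.Properties as Unique
open import Data.Nat.Properties using (_!≢0)
import Data.Nat.Properties as ℕₚ
open import Data.Product using (_×_; _,_; ∃-syntax; proj₁; proj₂)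
open import Data.Product.Properties using () renaming (≡-dec to ×-≡-dec)
open import Data.Rational as ℚ using (ℚ; 0ℚ; 1ℚ)
import Data.Rational.Properties as ℚₚ
open import Data.Sum using (_⊎_; inj₁; inj₂; [_,_])
open import Data.Unit using (tt)
open import Data.Vec as Vec using (Vec; zipWith; _[_]≔_)
open import Data.Vec.Membership.Propositional.Properties using (∈-toList⁺; ∈-allFin⁺)
open import Data.Vec.Properties
  using (zipWith-comm; zipWith-assoc; zipWith-identityˡ; zipWith-identityʳ; tabulate∘lookup;
         tabulate-cong; lookup∘tabulate; lookup∘update; lookup∘update′; lookup-allFin)
  renaming (≡-dec to Vec-≡-dec)
open import Function using (_∘_; id)
open import Function.Definitions using (Injective)
open import Function.Properties.Equivalence using () renaming (trans to ⇔-trans)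
open import Relation.Binary.Definitions using (tri<; tri≈; tri>)
open import Relation.Binary.PropositionalEquality
  using (_≡_; _≢_; refl; sym; trans; cong; cong₂; subst; subst₂; module ≡-Reasoning)
open import Relation.Nullary using (¬_; yes; no; contradiction)
open import Relation.Nullary.Decidable using (Dec; ⌊_⌋; _×-dec_; _⊎-dec_; toWitness; fromWitness)

private
  variable
    m n : ℕ
    A : Set

∈-++-∷⁻ : ∀ {x z : A} xs {ys} → z ∈ xs ++ x ∷ ys → z ≢ x → z ∈ xs ++ ys
∈-++-∷⁻ {x = x} xs {ys} z∈ z≢x with ∈-resp-↭ (shift x xs ys) z∈
... | here z≡x  = ⊥-elim (z≢x z≡x)
... | there z∈′ = z∈′

length≡0⇒≡[] : {xs : List A} → length xs ≡ 0 → xs ≡ []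
length≡0⇒≡[] {xs = []} _ = refl

length≡suc⇒∃∈ : {xs : List A} {k : ℕ} → length xs ≡ suc k → ∃[ x ] x ∈ xs
length≡suc⇒∃∈ {xs = x ∷ _} _ = x , here refl

unique-⊆⇒↭-++ : {xs ys : List A} → Unique xs → xs ⊆ ys → ∃[ zs ] ys ↭ xs ++ zs
unique-⊆⇒↭-++ {xs = []} {ys} _ _ = ys , ↭-refl
unique-⊆⇒↭-++ {xs = x ∷ xs} (x∉xs ∷ xs!) xs⊆ys with ∈-∃++ (xs⊆ys (here refl))
... | ys₁ , ys₂ , refl with unique-⊆⇒↭-++ xs! xs⊆ys₁++ys₂
  where
  xs⊆ys₁++ys₂ : xs ⊆ ys₁ ++ ys₂
  xs⊆ys₁++ys₂ z∈xs = ∈-++-∷⁻ ys₁ (xs⊆ys (there z∈xs)) λ where refl → All.lookup x∉xs z∈xs refl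
... | zs , ↭xs++zs = zs , ↭-trans (shift x ys₁ ys₂) (↭.prep x ↭xs++zs)

unique-⊆⇒length-≤ : {xs ys : List A} → Unique xs → xs ⊆ ys → length xs ≤ length ys
unique-⊆⇒length-≤ {xs = xs} {ys} xs! xs⊆ys with zs , ys↭ ← unique-⊆⇒↭-++ xs! xs⊆ys = begin
  length xs              ≤⟨ ℕₚ.m≤m+n (length xs) (length zs) ⟩
  length xs + length zs  ≡⟨ length-++ xs ⟨
  length (xs ++ zs)      ≡⟨ ↭-length ys↭ ⟨
  length ys              ∎
  where open ℕₚ.≤-Reasoning

unique-⊆-length⇒↭ : {xs ys : List A} → Unique xs → xs ⊆ ys → length ys ≤ length xs → ys ↭ xs
unique-⊆-length⇒↭ {xs = xs} {ys} xs! xs⊆ys ys≤xs with unique-⊆⇒↭-++ xs! xs⊆ys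
... | [] , ys↭ = ↭-trans ys↭ (↭-reflexive (++-identityʳ xs))
... | z ∷ zs , ys↭ = contradiction ys≤xs (ℕₚ.<⇒≱ (begin-strict
  length xs                    <⟨ ℕₚ.m<m+n (length xs) (s≤s z≤n) ⟩
  length xs + length (z ∷ zs)  ≡⟨ length-++ xs ⟨
  length (xs ++ z ∷ zs)        ≡⟨ ↭-length ys↭ ⟨
  length ys                    ∎))
  where open ℕₚ.≤-Reasoning

unique-⇔⇒↭ : {xs ys : List A} → Unique xs → Unique ys → (∀ {x} → x ∈ xs ⇔ x ∈ ys) → xs ↭ ys
unique-⇔⇒↭ xs! ys! xs⇔ys = ∼bag⇒↭ (unique∧set⇒bag xs! ys! xs⇔ys)

∈-filterᵇ⁻ : (p : A → Bool) {x : A} {xs : List A} → x ∈ filterᵇ p xs → x ∈ xs × T (p x)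
∈-filterᵇ⁻ p = ∈-filter⁻ (T? ∘ p)

∈-filterᵇ⁺ : (p : A → Bool) {x : A} {xs : List A} → x ∈ xs → T (p x) → x ∈ filterᵇ p xs
∈-filterᵇ⁺ p = ∈-filter⁺ (T? ∘ p)

filterᵇ-unique : (p : A → Bool) {xs : List A} → Unique xs → Unique (filterᵇ p xs)
filterᵇ-unique p = Unique.filter⁺ (T? ∘ p)

finList : ∀ n → List (Fin n)
finList n = Vec.toList (Vec.allFin n)

∈-finList : (i : Fin n) → i ∈ finList n
∈-finList i = ∈-toList⁺ (∈-allFin⁺ i)

toList-tabulate : (f : Fin n → A) → Vec.toList (Vec.tabulate f) ≡ List.tabulate f
toList-tabulate {n = zero}  f = refl
toList-tabulate {n = suc n} f = cong (f Fin.zero ∷_) (toList-tabulate (f ∘ Fin.suc))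

finList-unique : ∀ n → Unique (finList n)
finList-unique n = subst Unique (sym (toList-tabulate id)) (Unique.allFin⁺ n)

_⊕_ : Monomial m → Monomial m → Monomial m
_⊕_ = zipWith _+_

⊕-comm : Commutative _≡_ (_⊕_ {m})
⊕-comm = zipWith-comm ℕₚ.+-comm

⊕-assoc : Associative _≡_ (_⊕_ {m})
⊕-assoc = zipWith-assoc ℕₚ.+-assoc

⊕-identityˡ : (α : Monomial m) → zeroVec ⊕ α ≡ α
⊕-identityˡ = zipWith-identityˡ ℕₚ.+-identityˡ

⊕-identityʳ : (α : Monomial m) → α ⊕ zeroVec ≡ α
⊕-identityʳ = zipWith-identityʳ ℕₚ.+-identityʳ

⊕-left-comm : (α β γ : Monomial m) → α ⊕ (β ⊕ γ) ≡ β ⊕ (α ⊕ γ)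
⊕-left-comm α β γ = begin
  α ⊕ (β ⊕ γ)  ≡⟨ ⊕-assoc α β γ ⟨
  (α ⊕ β) ⊕ γ  ≡⟨ cong (_⊕ γ) (⊕-comm α β) ⟩
  (β ⊕ α) ⊕ γ  ≡⟨ ⊕-assoc β α γ ⟩
  β ⊕ (α ⊕ γ)  ∎
  where open ≡-Reasoning

MinkowskiSum-resp-↭ : {Ss Ts : List (List (Monomial m))} {α : Monomial m} →
                      Ss ↭ Ts → MinkowskiSum Ss α → MinkowskiSum Ts α
MinkowskiSum-resp-↭ ↭.refl α∈ = α∈
MinkowskiSum-resp-↭ (↭.prep S Ss↭Ts) (β , γ , β∈S , γ∈ , refl) =
  β , γ , β∈S , MinkowskiSum-resp-↭ Ss↭Ts γ∈ , refl
MinkowskiSum-resp-↭ (↭.swap S T Ss↭Ts) (β , _ , β∈S , (β′ , γ , β′∈T , γ∈ , refl) , refl) =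
  β′ , β ⊕ γ , β′∈T , (β , γ , β∈S , MinkowskiSum-resp-↭ Ss↭Ts γ∈ , refl) , ⊕-left-comm β β′ γ
MinkowskiSum-resp-↭ (↭.trans Ss↭Rs Rs↭Ts) α∈ =
  MinkowskiSum-resp-↭ Rs↭Ts (MinkowskiSum-resp-↭ Ss↭Rs α∈)

MinkowskiSum-mono : {Ss Ts : List (List (Monomial m))} {α : Monomial m} →
                    Pointwise _⊆_ Ss Ts → MinkowskiSum Ss α → MinkowskiSum Ts α
MinkowskiSum-mono [] α∈ = α∈
MinkowskiSum-mono (S⊆T ∷ Ss⊆Ts) (β , γ , β∈S , γ∈ , α≡) = β , γ , S⊆T β∈S , MinkowskiSum-mono Ss⊆Ts γ∈ , α≡

⟦_⟧ : OneLine n → Fin n → ℕ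
⟦ u ⟧ i = toℕ (Vec.lookup u i)

IsInversion : OneLine n → Pair n → Set
IsInversion u (a , b) = toℕ a < toℕ b × ⟦ u ⟧ b < ⟦ u ⟧ a

∈-pairs⁺ : {a b : Fin n} → toℕ a < toℕ b → (a , b) ∈ pairs n
∈-pairs⁺ {n} {a} {b} a<b = ∈-filterᵇ⁺ _ {xs = List.cartesianProduct (finList n) (finList n)}
  (∈-cartesianProduct⁺ (∈-finList a) (∈-finList b)) (ℕₚ.<⇒<ᵇ a<b)

∈-pairs⁻ : {a b : Fin n} → (a , b) ∈ pairs n → toℕ a < toℕ b
∈-pairs⁻ {n} ab∈ =
  ℕₚ.<ᵇ⇒< _ _ (proj₂ (∈-filterᵇ⁻ _ {xs = List.cartesianProduct (finList n) (finList n)} ab∈))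

pairs-unique : ∀ n → Unique (pairs n)
pairs-unique n =
  filterᵇ-unique _ (Unique.cartesianProduct⁺ (finList-unique n) (finList-unique n))

∈-Inv⁺ : (u : OneLine n) {t : Pair n} → IsInversion u t → t ∈ Inv u
∈-Inv⁺ {n} u (a<b , ub<ua) = ∈-filterᵇ⁺ _ {xs = pairs n} (∈-pairs⁺ a<b) (ℕₚ.<⇒<ᵇ ub<ua)

∈-Inv⁻ : (u : OneLine n) {t : Pair n} → t ∈ Inv u → IsInversion u t
∈-Inv⁻ {n} u t∈ with t∈pairs , ub<ᵇua ← ∈-filterᵇ⁻ _ {xs = pairs n} t∈ = ∈-pairs⁻ t∈pairs , ℕₚ.<ᵇ⇒< _ _ ub<ᵇua

Inv-unique : (u : OneLine n) → Unique (Inv u)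
Inv-unique {n} u = filterᵇ-unique _ (pairs-unique n)

∈-varsBetween⁻ : {a b : Fin (suc m)} {i : Fin m} →
                 i ∈ varsBetween (a , b) → toℕ a ≤ toℕ i × toℕ i < toℕ b
∈-varsBetween⁻ {m} i∈ with _ , a≤i∧i<b ← ∈-filterᵇ⁻ _ {xs = finList m} i∈ with a≤i , i<b ← Equivalence.to T-∧ a≤i∧i<b =
  ℕₚ.≤ᵇ⇒≤ _ _ a≤i , ℕₚ.<ᵇ⇒< _ _ i<b

∈-varsBetween⁺ : {a b : Fin (suc m)} {i : Fin m} →
                 toℕ a ≤ toℕ i → toℕ i < toℕ b → i ∈ varsBetween (a , b)
∈-varsBetween⁺ {m} {i = i} a≤i i<b =
  ∈-filterᵇ⁺ _ {xs = finList m} (∈-finList i) (Equivalence.from T-∧ (ℕₚ.≤⇒≤ᵇ a≤i , ℕₚ.<⇒<ᵇ i<b))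

_⊑_ : Pair n → Pair n → Set
(p , q) ⊑ (p′ , q′) = toℕ p′ ≤ toℕ p × toℕ q ≤ toℕ q′

⊑-refl : {t : Pair n} → t ⊑ t
⊑-refl = ℕₚ.≤-refl , ℕₚ.≤-refl

basisSegment-mono : {s t : Pair (suc m)} → s ⊑ t → basisSegment s ⊆ basisSegment t
basisSegment-mono (a′≤a , b≤b′) x∈ with i , i∈ , refl ← ∈-map⁻ e x∈ with a≤i , i<b ← ∈-varsBetween⁻ i∈ =
  ∈-map⁺ e (∈-varsBetween⁺ (ℕₚ.≤-trans a′≤a a≤i) (ℕₚ.<-≤-trans i<b b≤b′))

τ : Fin n → Fin n → Fin n → Fin n
τ a b i with i Fin.≟ a | i Fin.≟ b
... | yes _ | _     = b
... | no _  | yes _ = a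
... | no _  | no _  = i

data TranspositionView {n} (a b i : Fin n) : Fin n → Set where
  at-a      : i ≡ a → TranspositionView a b i b
  at-b      : i ≢ a → i ≡ b → TranspositionView a b i a
  elsewhere : i ≢ a → i ≢ b → TranspositionView a b i i

τ-view : (a b i : Fin n) → TranspositionView a b i (τ a b i)
τ-view a b i with i Fin.≟ a | i Fin.≟ b
... | yes i≡a | _       = at-a i≡a
... | no i≢a  | yes i≡b = at-b i≢a i≡b
... | no i≢a  | no i≢b  = elsewhere i≢a i≢b

τ-a : (a b : Fin n) → τ a b a ≡ b
τ-a a b with τ a b a | τ-view a b a
... | _ | at-a _          = refl
... | _ | at-b a≢a _      = contradiction refl a≢a
... | _ | elsewhere a≢a _ = contradiction refl a≢a

τ-b : {a b : Fin n} → a ≢ b → τ a b b ≡ a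
τ-b {a = a} {b} a≢b with τ a b b | τ-view a b b
... | _ | at-a b≡a        = contradiction (sym b≡a) a≢b
... | _ | at-b _ _        = refl
... | _ | elsewhere _ b≢b = contradiction refl b≢b

τ-fix : {a b i : Fin n} → i ≢ a → i ≢ b → τ a b i ≡ i
τ-fix {a = a} {b} {i} i≢a i≢b with τ a b i | τ-view a b i
... | _ | at-a i≡a      = contradiction i≡a i≢a
... | _ | at-b _ i≡b    = contradiction i≡b i≢b
... | _ | elsewhere _ _ = refl

τ-involutive : {a b : Fin n} → a ≢ b → ∀ i → τ a b (τ a b i) ≡ i
τ-involutive {a = a} {b} a≢b i with τ a b i | τ-view a b i
... | _ | at-a refl     = τ-b a≢b
... | _ | at-b _ refl   = τ-a a b
... | _ | elsewhere i≢a i≢b = τ-fix i≢a i≢b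

τ-injective : {a b : Fin n} → a ≢ b → Injective _≡_ _≡_ (τ a b)
τ-injective a≢b {i} {j} τi≡τj =
  trans (sym (τ-involutive a≢b i)) (trans (cong (τ _ _) τi≡τj) (τ-involutive a≢b j))

lookup-ext : {xs ys : Vec A n} → (∀ i → Vec.lookup xs i ≡ Vec.lookup ys i) → xs ≡ ys
lookup-ext {xs = xs} {ys} xs≗ys =
  trans (sym (tabulate∘lookup xs)) (trans (tabulate-cong xs≗ys) (tabulate∘lookup ys))

lookup-swap : (u : OneLine n) {a b : Fin n} → a ≢ b →
              ∀ i → Vec.lookup (swap u (a , b)) i ≡ Vec.lookup u (τ a b i)
lookup-swap u {a} {b} a≢b i with τ a b i | τ-view a b i
... | _ | at-a refl =
  trans (lookup∘update′ a≢b (u [ a ]≔ Vec.lookup u b) _) (lookup∘update a u _)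
... | _ | at-b _ refl =
  lookup∘update b (u [ a ]≔ Vec.lookup u b) _
... | _ | elsewhere i≢a i≢b =
  trans (lookup∘update′ i≢b (u [ a ]≔ Vec.lookup u b) _) (lookup∘update′ i≢a u _)

⟦⟧-swap : (u : OneLine n) {a b : Fin n} → a ≢ b → ∀ i → ⟦ swap u (a , b) ⟧ i ≡ ⟦ u ⟧ (τ a b i)
⟦⟧-swap u a≢b i = cong toℕ (lookup-swap u a≢b i)

⟦⟧-swap-τ : (u : OneLine n) {a b : Fin n} → a ≢ b → ∀ i → ⟦ swap u (a , b) ⟧ (τ a b i) ≡ ⟦ u ⟧ i
⟦⟧-swap-τ u a≢b i = trans (⟦⟧-swap u a≢b _) (cong ⟦ u ⟧ (τ-involutive a≢b i))

⟦⟧-swap-a : (u : OneLine n) {a b : Fin n} → a ≢ b → ⟦ swap u (a , b) ⟧ a ≡ ⟦ u ⟧ b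
⟦⟧-swap-a u {a} {b} a≢b = trans (⟦⟧-swap u a≢b a) (cong ⟦ u ⟧ (τ-a a b))

⟦⟧-swap-b : (u : OneLine n) {a b : Fin n} → a ≢ b → ⟦ swap u (a , b) ⟧ b ≡ ⟦ u ⟧ a
⟦⟧-swap-b u a≢b = trans (⟦⟧-swap u a≢b _) (cong ⟦ u ⟧ (τ-b a≢b))

swap-involutive : (u : OneLine n) {a b : Fin n} → a ≢ b → swap (swap u (a , b)) (a , b) ≡ u
swap-involutive u a≢b = lookup-ext λ i → begin
  Vec.lookup (swap (swap u _) _) i    ≡⟨ lookup-swap (swap u _) a≢b i ⟩
  Vec.lookup (swap u _) (τ _ _ i)     ≡⟨ lookup-swap u a≢b _ ⟩
  Vec.lookup u (τ _ _ (τ _ _ i))      ≡⟨ cong (Vec.lookup u) (τ-involutive a≢b i) ⟩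
  Vec.lookup u i                      ∎
  where open ≡-Reasoning

swap-injective : (u : OneLine n) {a b : Fin n} → a ≢ b →
                 Injective _≡_ _≡_ (Vec.lookup u) → Injective _≡_ _≡_ (Vec.lookup (swap u (a , b)))
swap-injective u a≢b u-inj {i} {j} eq =
  τ-injective a≢b (u-inj (trans (sym (lookup-swap u a≢b i)) (trans eq (lookup-swap u a≢b j))))

oneLine-injective : (w : Permutation′ n) → Injective _≡_ _≡_ (Vec.lookup (oneLine w))
oneLine-injective w {i} {j} eq = begin
  i                     ≡⟨ inverseˡ w ⟨
  w ⟨$⟩ˡ (w ⟨$⟩ʳ i)     ≡⟨ cong (w ⟨$⟩ˡ_) (trans (sym (lookup∘tabulate _ i)) (trans eq (lookup∘tabulate _ j))) ⟩
  w ⟨$⟩ˡ (w ⟨$⟩ʳ j)     ≡⟨ inverseˡ w ⟩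
  j                     ∎
  where open ≡-Reasoning

identity-injective : Injective _≡_ _≡_ (Vec.lookup (identity {n}))
identity-injective {x = i} {y = j} eq = trans (sym (lookup-allFin i)) (trans eq (lookup-allFin j))

module _ (f : Fin n → Fin n) (f-mono : ∀ {i j} → toℕ i < toℕ j → toℕ (f i) < toℕ (f j)) where

  private
    i≤fi : ∀ k (i : Fin n) → toℕ i ≡ k → k ≤ toℕ (f i)
    i≤fi zero    i _     = z≤n
    i≤fi (suc k) i i≡1+k = ℕₚ.≤-<-trans (i≤fi k j (toℕ-fromℕ< k<n)) (f-mono j<i)
      where
      k<i : k < toℕ i
      k<i = subst (k <_) (sym i≡1+k) (ℕₚ.n<1+n k)
      k<n : k < n
      k<n = ℕₚ.<-trans k<i (toℕ<n i)
      j : Fin n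
      j = Fin.fromℕ< k<n
      j<i : toℕ j < toℕ i
      j<i = subst (_< toℕ i) (sym (toℕ-fromℕ< k<n)) k<i

    fi+d<n : ∀ d (i : Fin n) → toℕ i + d < n → toℕ (f i) + d < n
    fi+d<n zero    i _ = subst (_< n) (sym (ℕₚ.+-identityʳ _)) (toℕ<n (f i))
    fi+d<n (suc d) i i+1+d<n = begin-strict
      toℕ (f i) + suc d    ≡⟨ ℕₚ.+-suc (toℕ (f i)) d ⟩
      suc (toℕ (f i)) + d  ≤⟨ ℕₚ.+-monoˡ-≤ d (f-mono i<j) ⟩
      toℕ (f j) + d        <⟨ fi+d<n d j j+d<n ⟩
      n                    ∎
      where
      open ℕₚ.≤-Reasoning
      1+i+d<n : suc (toℕ i) + d < n
      1+i+d<n = subst (_< n) (ℕₚ.+-suc (toℕ i) d) i+1+d<n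
      1+i<n : suc (toℕ i) < n
      1+i<n = ℕₚ.≤-<-trans (ℕₚ.m≤m+n (suc (toℕ i)) d) 1+i+d<n
      j : Fin n
      j = Fin.fromℕ< 1+i<n
      i<j : toℕ i < toℕ j
      i<j = subst (toℕ i <_) (sym (toℕ-fromℕ< 1+i<n)) (ℕₚ.n<1+n (toℕ i))
      j+d<n : toℕ j + d < n
      j+d<n = subst (λ x → x + d < n) (sym (toℕ-fromℕ< 1+i<n)) 1+i+d<n

  strictlyIncreasing⇒identity : ∀ i → f i ≡ i
  strictlyIncreasing⇒identity i = toℕ-injective (ℕₚ.≤-antisym fi≤i (i≤fi (toℕ i) i refl))
    where
    d : ℕ
    d = n ∸ suc (toℕ i)
    1+i+d≡n : suc (toℕ i) + d ≡ n
    1+i+d≡n = ℕₚ.m+[n∸m]≡n (toℕ<n i)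
    fi≤i : toℕ (f i) ≤ toℕ i
    fi≤i = ℕₚ.≤-pred (ℕₚ.+-cancelʳ-≤ d _ _
             (subst (suc (toℕ (f i)) + d ≤_) (sym 1+i+d≡n) (fi+d<n d i (ℕₚ.≤-reflexive 1+i+d≡n))))

noInversions⇒identity : (u : OneLine n) → Injective _≡_ _≡_ (Vec.lookup u) → Inv u ≡ [] → u ≡ identity
noInversions⇒identity u u-inj Inv≡[] =
  lookup-ext λ i → trans (strictlyIncreasing⇒identity (Vec.lookup u) increasing i) (sym (lookup-allFin i))
  where
  increasing : ∀ {i j} → toℕ i < toℕ j → ⟦ u ⟧ i < ⟦ u ⟧ j
  increasing {i} {j} i<j with ℕₚ.<-cmp (⟦ u ⟧ i) (⟦ u ⟧ j)
  ... | tri< ui<uj _ _ = ui<uj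
  ... | tri≈ _ ui≡uj _ = contradiction (cong toℕ (u-inj (toℕ-injective ui≡uj))) (ℕₚ.<⇒≢ i<j)
  ... | tri> _ _ uj<ui = contradiction (subst ((i , j) ∈_) Inv≡[] (∈-Inv⁺ u (i<j , uj<ui))) λ ()

identity-inversion-free : {t : Pair n} → ¬ IsInversion identity t
identity-inversion-free {t = a , b} (a<b , b<a) =
  ℕₚ.<-asym a<b (subst₂ _<_ (cong toℕ (lookup-allFin b)) (cong toℕ (lookup-allFin a)) b<a)

Inv-identity : Inv (identity {n}) ≡ []
Inv-identity {n} with Inv (identity {n}) in Inv≡
... | []    = refl
... | t ∷ _ = contradiction (∈-Inv⁻ identity (subst (t ∈_) (sym Inv≡) (here refl))) identity-inversion-free

-- Removing an inversion between adjacent values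

NothingBetween : OneLine n → Fin n → Fin n → Set
NothingBetween u i j = ∀ k → ⟦ u ⟧ i < ⟦ u ⟧ k → ⟦ u ⟧ k < ⟦ u ⟧ j → ⊥

⟦⟧-injective : (u : OneLine n) → Injective _≡_ _≡_ (Vec.lookup u) → {i j : Fin n} → i ≢ j → ⟦ u ⟧ i ≢ ⟦ u ⟧ j
⟦⟧-injective u u-inj i≢j ui≡uj = i≢j (u-inj (toℕ-injective ui≡uj))

≢∧≮⇒> : {x y : ℕ} → x ≢ y → ¬ x < y → y < x
≢∧≮⇒> x≢y x≮y = ℕₚ.≤∧≢⇒< (ℕₚ.≮⇒≥ x≮y) (x≢y ∘ sym)

toℕ-<⇒≢ : {i j : Fin n} → toℕ i < toℕ j → i ≢ j
toℕ-<⇒≢ i<j i≡j = ℕₚ.<⇒≢ i<j (cong toℕ i≡j)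

∃-adjacentInversion : (u : OneLine n) {t : Pair n} → IsInversion u t →
                      ∃[ s ] (IsInversion u s × NothingBetween u (proj₂ s) (proj₁ s))
∃-adjacentInversion u {a , b} inv = narrow (⟦ u ⟧ a) inv (ℕₚ.m≤n+m (⟦ u ⟧ a) (⟦ u ⟧ b))
  where
  -- k bounds the value gap ⟦ u ⟧ a ∸ ⟦ u ⟧ b; a value strictly inside it gives a smaller gap.
  narrow : ∀ k {a b} → IsInversion u (a , b) → ⟦ u ⟧ a ≤ ⟦ u ⟧ b + k →
           ∃[ s ] (IsInversion u s × NothingBetween u (proj₂ s) (proj₁ s))
  narrow zero {a} (_ , ub<ua) ua≤ub+0 =
    contradiction (subst (⟦ u ⟧ a ≤_) (ℕₚ.+-identityʳ _) ua≤ub+0) (ℕₚ.<⇒≱ ub<ua)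
  narrow (suc k) {a} {b} (a<b , ub<ua) ua≤ub+1+k
    with any? (λ c → (⟦ u ⟧ b ℕₚ.<? ⟦ u ⟧ c) ×-dec (⟦ u ⟧ c ℕₚ.<? ⟦ u ⟧ a))
  ... | no ∄c = (a , b) , (a<b , ub<ua) , λ c ub<uc uc<ua → ∄c (c , ub<uc , uc<ua)
  ... | yes (c , ub<uc , uc<ua) with ℕₚ.<-cmp (toℕ c) (toℕ a)
  ...   | tri< c<a _ _ = narrow k (ℕₚ.<-trans c<a a<b , ub<uc)
                           (ℕₚ.≤-pred (ℕₚ.<-≤-trans uc<ua (subst (⟦ u ⟧ a ≤_) (ℕₚ.+-suc _ k) ua≤ub+1+k)))
  ...   | tri≈ _ c≡a _ = contradiction (cong ⟦ u ⟧ (toℕ-injective c≡a)) (ℕₚ.<⇒≢ uc<ua)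
  ...   | tri> _ _ a<c = narrow k (a<c , uc<ua)
                           (ℕₚ.≤-trans ua≤ub+1+k (subst (_≤ ⟦ u ⟧ c + k) (sym (ℕₚ.+-suc _ k)) (ℕₚ.+-monoˡ-≤ k ub<uc)))

module _ (u : OneLine n) (u-inj : Injective _≡_ _≡_ (Vec.lookup u)) {a b : Fin n} (a≢b : a ≢ b)
         (gap-ab : NothingBetween u a b) (gap-ba : NothingBetween u b a) where

  adjacentSwap-reflects-< : ∀ {i j} → (i , j) ≢ (a , b) → (i , j) ≢ (b , a) →
                            ⟦ u ⟧ (τ a b j) < ⟦ u ⟧ (τ a b i) → ⟦ u ⟧ j < ⟦ u ⟧ i
  adjacentSwap-reflects-< {i} {j} ij≢ab ij≢ba with τ a b i | τ-view a b i | τ a b j | τ-view a b j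
  ... | _ | at-a refl        | _ | at-a refl          = ⊥-elim ∘ ℕₚ.<-irrefl refl
  ... | _ | at-a refl        | _ | at-b _ refl        = contradiction refl ij≢ab
  ... | _ | at-a refl        | _ | elsewhere j≢a _    = λ uj<ub →
    ≢∧≮⇒> (⟦⟧-injective u u-inj (j≢a ∘ sym)) (λ ua<uj → gap-ab j ua<uj uj<ub)
  ... | _ | at-b _ refl      | _ | at-a refl          = contradiction refl ij≢ba
  ... | _ | at-b _ refl      | _ | at-b _ refl        = ⊥-elim ∘ ℕₚ.<-irrefl refl
  ... | _ | at-b _ refl      | _ | elsewhere _ j≢b    = λ uj<ua →
    ≢∧≮⇒> (⟦⟧-injective u u-inj (j≢b ∘ sym)) (λ ub<uj → gap-ba j ub<uj uj<ua)
  ... | _ | elsewhere i≢a _  | _ | at-a refl          = λ ub<ui →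
    ≢∧≮⇒> (⟦⟧-injective u u-inj i≢a) (λ ui<ua → gap-ba i ub<ui ui<ua)
  ... | _ | elsewhere _ i≢b  | _ | at-b _ refl        = λ ua<ui →
    ≢∧≮⇒> (⟦⟧-injective u u-inj i≢b) (λ ui<ub → gap-ab i ua<ui ui<ub)
  ... | _ | elsewhere _ _    | _ | elsewhere _ _      = id

module _ (u : OneLine n) (u-inj : Injective _≡_ _≡_ (Vec.lookup u)) {a b : Fin n}
         (ab-inv : IsInversion u (a , b)) (gap : NothingBetween u b a) where

  private
    a<b : toℕ a < toℕ b
    a<b = proj₁ ab-inv
    ub<ua : ⟦ u ⟧ b < ⟦ u ⟧ a
    ub<ua = proj₂ ab-inv
    a≢b : a ≢ b
    a≢b = toℕ-<⇒≢ a<b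
    v : OneLine n
    v = swap u (a , b)
    ⟦v⟧a : ⟦ v ⟧ a ≡ ⟦ u ⟧ b
    ⟦v⟧a = ⟦⟧-swap-a u a≢b
    ⟦v⟧b : ⟦ v ⟧ b ≡ ⟦ u ⟧ a
    ⟦v⟧b = ⟦⟧-swap-b u a≢b
    u-gap-ab : NothingBetween u a b
    u-gap-ab c ua<uc uc<ub = ℕₚ.<-asym (ℕₚ.<-trans ua<uc uc<ub) ub<ua
    v-gap-ab : NothingBetween v a b
    v-gap-ab c va<vc vc<vb = gap (τ a b c)
      (subst₂ _<_ ⟦v⟧a (⟦⟧-swap u a≢b c) va<vc) (subst₂ _<_ (⟦⟧-swap u a≢b c) ⟦v⟧b vc<vb)
    v-gap-ba : NothingBetween v b a
    v-gap-ba c vb<vc vc<va = ℕₚ.<-asym (subst₂ _<_ ⟦v⟧b ⟦v⟧a (ℕₚ.<-trans vb<vc vc<va)) ub<ua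
    not-reversed : ∀ {p q : Fin n} → toℕ p < toℕ q → (p , q) ≢ (b , a)
    not-reversed p<q refl = ℕₚ.<-asym p<q a<b
    ab∉Inv-v : (a , b) ∉ Inv v
    ab∉Inv-v ab∈ = ℕₚ.<-asym ub<ua (subst₂ _<_ ⟦v⟧b ⟦v⟧a (proj₂ (∈-Inv⁻ v ab∈)))

    Inv-v⊆Inv-u : Inv v ⊆ Inv u
    Inv-v⊆Inv-u {p , q} pq∈ with p<q , vq<vp ← ∈-Inv⁻ v pq∈ = ∈-Inv⁺ u (p<q ,
      adjacentSwap-reflects-< u u-inj a≢b u-gap-ab gap (λ where refl → ab∉Inv-v pq∈) (not-reversed p<q)
        (subst₂ _<_ (⟦⟧-swap u a≢b q) (⟦⟧-swap u a≢b p) vq<vp))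

    Inv-u⊆Inv-v : ∀ {t} → t ∈ Inv u → t ≢ (a , b) → t ∈ Inv v
    Inv-u⊆Inv-v {p , q} pq∈ pq≢ab with p<q , uq<up ← ∈-Inv⁻ u pq∈ = ∈-Inv⁺ v (p<q ,
      adjacentSwap-reflects-< v (swap-injective u a≢b u-inj) a≢b v-gap-ab v-gap-ba pq≢ab (not-reversed p<q)
        (subst₂ _<_ (sym (⟦⟧-swap-τ u a≢b q)) (sym (⟦⟧-swap-τ u a≢b p)) uq<up))

  Inv-adjacentSwap-↭ : Inv u ↭ (a , b) ∷ Inv v
  Inv-adjacentSwap-↭ = unique-⇔⇒↭ (Inv-unique u) (All.tabulate ab≢ ∷ Inv-unique v) (mk⇔ to from)
    where
    ab≢ : ∀ {t} → t ∈ Inv v → (a , b) ≢ t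
    ab≢ t∈ refl = ab∉Inv-v t∈
    to : ∀ {t} → t ∈ Inv u → t ∈ (a , b) ∷ Inv v
    to {t} t∈ with ×-≡-dec Fin._≟_ Fin._≟_ t (a , b)
    ... | yes refl = here refl
    ... | no t≢ab  = there (Inv-u⊆Inv-v t∈ t≢ab)
    from : ∀ {t} → t ∈ (a , b) ∷ Inv v → t ∈ Inv u
    from (here refl) = ∈-Inv⁺ u ab-inv
    from (there t∈)  = Inv-v⊆Inv-u t∈

-- Inversions along a cover u ⋖ u t_ab

module CoverInjection (u : OneLine n) (u-inj : Injective _≡_ _≡_ (Vec.lookup u)) {a b : Fin n}
                      (a<b : toℕ a < toℕ b) (ua<ub : ⟦ u ⟧ a < ⟦ u ⟧ b) where

  private
    a≢b : a ≢ b
    a≢b = toℕ-<⇒≢ a<b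
    v : OneLine n
    v = swap u (a , b)

  -- ψ keeps every inversion of u that is still one of u t_ab; the others (one end in {a, b},
  -- the other outside [a, b] with value between u(a) and u(b)) are sent by t_ab to inversions
  -- of u t_ab with wider segments.

  IsEnd : Fin n → Set
  IsEnd x = x ≡ a ⊎ x ≡ b

  Jumped : Fin n → Set
  Jumped z = (toℕ z < toℕ a ⊎ toℕ b < toℕ z) × ⟦ u ⟧ a < ⟦ u ⟧ z × ⟦ u ⟧ z < ⟦ u ⟧ b

  Moved : Pair n → Set
  Moved (x , y) = (IsEnd x × Jumped y) ⊎ (IsEnd y × Jumped x)

  Moved? : (t : Pair n) → Dec (Moved t)
  Moved? (x , y) = (IsEnd? x ×-dec Jumped? y) ⊎-dec (IsEnd? y ×-dec Jumped? x)
    where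
    IsEnd? : ∀ x → Dec (IsEnd x)
    IsEnd? x = (x Fin.≟ a) ⊎-dec (x Fin.≟ b)
    Jumped? : ∀ z → Dec (Jumped z)
    Jumped? z = ((toℕ z ℕₚ.<? toℕ a) ⊎-dec (toℕ b ℕₚ.<? toℕ z))
                ×-dec (⟦ u ⟧ a ℕₚ.<? ⟦ u ⟧ z) ×-dec (⟦ u ⟧ z ℕₚ.<? ⟦ u ⟧ b)

  τ² : Pair n → Pair n
  τ² (x , y) = τ a b x , τ a b y

  ψ : Pair n → Pair n
  ψ t with Moved? t
  ... | yes _ = τ² t
  ... | no _  = t

  private
    IsEnd-τ : ∀ {x} → IsEnd x → IsEnd (τ a b x)
    IsEnd-τ (inj₁ refl) = inj₂ (τ-a a b)
    IsEnd-τ (inj₂ refl) = inj₁ (τ-b a≢b)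

    Jumped-τ : ∀ {z} → Jumped z → Jumped (τ a b z)
    Jumped-τ {z} jz@(z∉[a,b] , _) = subst Jumped (sym (τ-fix z≢a z≢b)) jz
      where
      z≢a : z ≢ a
      z≢a refl = [ ℕₚ.<-irrefl refl , ℕₚ.<-asym a<b ] z∉[a,b]
      z≢b : z ≢ b
      z≢b refl = [ ℕₚ.<-asym a<b , ℕₚ.<-irrefl refl ] z∉[a,b]

    Moved-τ² : ∀ {t} → Moved t → Moved (τ² t)
    Moved-τ² (inj₁ (ex , jy)) = inj₁ (IsEnd-τ ex , Jumped-τ jy)
    Moved-τ² (inj₂ (ey , jx)) = inj₂ (IsEnd-τ ey , Jumped-τ jx)

    Jumped-a : ¬ Jumped a
    Jumped-a (_ , ua<ua , _) = ℕₚ.<-irrefl refl ua<ua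

    Jumped-b : ¬ Jumped b
    Jumped-b (_ , _ , ub<ub) = ℕₚ.<-irrefl refl ub<ub

  ψ-moved : ∀ {t} → Moved t → ψ t ≡ τ² t
  ψ-moved {t} moved with Moved? t
  ... | yes _     = refl
  ... | no ¬moved = contradiction moved ¬moved

  ψ-unmoved : ∀ {t} → ¬ Moved t → ψ t ≡ t
  ψ-unmoved {t} ¬moved with Moved? t
  ... | yes moved = contradiction moved ¬moved
  ... | no _      = refl

  ψ-involutive : ∀ t → ψ (ψ t) ≡ t
  ψ-involutive t with Moved? t
  ... | yes moved = trans (ψ-moved (Moved-τ² moved)) (cong₂ _,_ (τ-involutive a≢b _) (τ-involutive a≢b _))
  ... | no ¬moved = ψ-unmoved ¬moved

  ψ-injective : Injective _≡_ _≡_ ψ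
  ψ-injective {s} {t} ψs≡ψt = trans (sym (ψ-involutive s)) (trans (cong ψ ψs≡ψt) (ψ-involutive t))

  ψ-ab : ψ (a , b) ≡ (a , b)
  ψ-ab = ψ-unmoved λ where
    (inj₁ (_ , jumped)) → Jumped-b jumped
    (inj₂ (_ , jumped)) → Jumped-a jumped

  private
    moved-widens : ∀ {p q} → IsInversion u (p , q) → Moved (p , q) →
                   toℕ (τ a b p) < toℕ (τ a b q) × (p , q) ⊑ τ² (p , q)
    moved-widens (_ , uq<ua) (inj₁ (inj₁ refl , _ , ua<uq , _)) = ⊥-elim (ℕₚ.<-asym uq<ua ua<uq)
    moved-widens (b<q , _) (inj₁ (inj₂ refl , inj₁ q<a , _)) = ⊥-elim (ℕₚ.<-asym (ℕₚ.<-trans q<a a<b) b<q)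
    moved-widens {q = q} (b<q , _) (inj₁ (inj₂ refl , inj₂ _ , _))
      rewrite τ-b a≢b | τ-fix {i = q} (toℕ-<⇒≢ (ℕₚ.<-trans a<b b<q) ∘ sym) (toℕ-<⇒≢ b<q ∘ sym) =
      ℕₚ.<-trans a<b b<q , ℕₚ.<⇒≤ a<b , ℕₚ.≤-refl
    moved-widens {p = p} (p<a , _) (inj₂ (inj₁ refl , inj₁ _ , _))
      rewrite τ-a a b | τ-fix {i = p} (toℕ-<⇒≢ p<a) (toℕ-<⇒≢ (ℕₚ.<-trans p<a a<b)) =
      ℕₚ.<-trans p<a a<b , ℕₚ.≤-refl , ℕₚ.<⇒≤ a<b
    moved-widens (p<a , _) (inj₂ (inj₁ refl , inj₂ b<p , _)) = ⊥-elim (ℕₚ.<-asym (ℕₚ.<-trans b<p p<a) a<b)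
    moved-widens (_ , ub<up) (inj₂ (inj₂ refl , _ , _ , up<ub)) = ⊥-elim (ℕₚ.<-asym ub<up up<ub)

    unmoved-inversion : ∀ {p q} → IsInversion u (p , q) → ¬ Moved (p , q) → ⟦ u ⟧ (τ a b q) < ⟦ u ⟧ (τ a b p)
    unmoved-inversion {p} {q} (p<q , uq<up) ¬moved with τ a b p | τ-view a b p | τ a b q | τ-view a b q
    ... | _ | at-a refl       | _ | at-a refl       = ⊥-elim (ℕₚ.<-irrefl refl p<q)
    ... | _ | at-a refl       | _ | at-b _ refl     = ⊥-elim (ℕₚ.<-asym ua<ub uq<up)
    ... | _ | at-a refl       | _ | elsewhere _ _   = ℕₚ.<-trans uq<up ua<ub
    ... | _ | at-b _ refl     | _ | at-a refl       = ⊥-elim (ℕₚ.<-asym a<b p<q)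
    ... | _ | at-b _ refl     | _ | at-b _ refl     = ⊥-elim (ℕₚ.<-irrefl refl p<q)
    ... | _ | at-b _ refl     | _ | elsewhere q≢a _ =
      ≢∧≮⇒> (⟦⟧-injective u u-inj (q≢a ∘ sym)) λ ua<uq → ¬moved (inj₁ (inj₂ refl , inj₂ p<q , ua<uq , uq<up))
    ... | _ | elsewhere _ p≢b | _ | at-a refl       =
      ≢∧≮⇒> (⟦⟧-injective u u-inj p≢b) λ up<ub → ¬moved (inj₂ (inj₁ refl , inj₁ p<q , uq<up , up<ub))
    ... | _ | elsewhere _ _   | _ | at-b _ refl     = ℕₚ.<-trans ua<ub uq<up
    ... | _ | elsewhere _ _   | _ | elsewhere _ _   = uq<up

  ψ-inversion-widens : ∀ {t} → t ∈ Inv u → ψ t ∈ Inv v × t ⊑ ψ t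
  ψ-inversion-widens {p , q} t∈ with p<q , uq<up ← ∈-Inv⁻ u t∈ | Moved? (p , q)
  ... | yes moved with τp<τq , widened ← moved-widens (p<q , uq<up) moved =
    ∈-Inv⁺ v (τp<τq , subst₂ _<_ (sym (⟦⟧-swap-τ u a≢b q)) (sym (⟦⟧-swap-τ u a≢b p)) uq<up) , widened
  ... | no ¬moved =
    ∈-Inv⁺ v (p<q , subst₂ _<_ (sym (⟦⟧-swap u a≢b q)) (sym (⟦⟧-swap u a≢b p))
                      (unmoved-inversion (p<q , uq<up) ¬moved)) , ⊑-refl

  coverInversions : List (Pair n)
  coverInversions = (a , b) ∷ map ψ (Inv u)

  coverInversions-unique : Unique coverInversions
  coverInversions-unique = All.tabulate ab≢ ∷ Unique.map⁺ ψ-injective (Inv-unique u)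
    where
    ab≢ : ∀ {t} → t ∈ map ψ (Inv u) → (a , b) ≢ t
    ab≢ t∈ refl with s , s∈ , ab≡ψs ← ∈-map⁻ ψ t∈ =
      ℕₚ.<-asym ua<ub (proj₂ (∈-Inv⁻ u (subst (_∈ Inv u) (ψ-injective (trans (sym ab≡ψs) (sym ψ-ab))) s∈)))

  coverInversions⊆Inv-v : coverInversions ⊆ Inv v
  coverInversions⊆Inv-v (here refl) = ∈-Inv⁺ v (a<b , subst₂ _<_ (sym (⟦⟧-swap-b u a≢b)) (sym (⟦⟧-swap-a u a≢b)) ua<ub)
  coverInversions⊆Inv-v (there t∈) with s , s∈ , refl ← ∈-map⁻ ψ t∈ = proj₁ (ψ-inversion-widens s∈)

  suc-len≤len-swap : suc (len u) ≤ len v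
  suc-len≤len-swap = subst (_≤ len v) (cong suc (length-map ψ (Inv u)))
    (unique-⊆⇒length-≤ coverInversions-unique coverInversions⊆Inv-v)

  Inv-swap-↭ : len v ≤ suc (len u) → Inv v ↭ coverInversions
  Inv-swap-↭ len-v≤ = unique-⊆-length⇒↭ coverInversions-unique coverInversions⊆Inv-v
    (subst (len v ≤_) (cong suc (sym (length-map ψ (Inv u)))) len-v≤)

Covers : OneLine n → Pair n → Set
Covers u (a , b) = toℕ a < toℕ b × len (swap u (a , b)) ≡ suc (len u)

isSaturated-∷⁻ : (u : OneLine n) {t : Pair n} (c : List (Pair n)) →
                 T (isSaturated u (t ∷ c)) → Covers u t × T (isSaturated (swap u t) c)
isSaturated-∷⁻ u c sat with a<b , sat′ ← Equivalence.to T-∧ sat with len≡ , sat″ ← Equivalence.to T-∧ sat′ =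
  (ℕₚ.<ᵇ⇒< _ _ a<b , toWitness len≡) , sat″

endpoint-++ : (u : OneLine n) (c d : List (Pair n)) → endpoint u (c ++ d) ≡ endpoint (endpoint u c) d
endpoint-++ u []      d = refl
endpoint-++ u (t ∷ c) d = endpoint-++ (swap u t) c d

isSaturated-++ : (u : OneLine n) (c d : List (Pair n)) →
                 isSaturated u (c ++ d) ≡ isSaturated u c ∧ isSaturated (endpoint u c) d
isSaturated-++ u []      d = refl
isSaturated-++ u (t@(a , b) ∷ c) d rewrite isSaturated-++ (swap u t) c d =
  sym (trans (∧-assoc ascent _ _) (cong (ascent ∧_) (∧-assoc lengthStep (isSaturated (swap u t) c) _)))
  where
  ascent lengthStep : Bool
  ascent     = toℕ a <ᵇ toℕ b
  lengthStep = ⌊ len (swap u t) ≟ suc (len u) ⌋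

isSaturated-∷ʳ⁺ : (u : OneLine n) {t : Pair n} (c : List (Pair n)) →
                  T (isSaturated u c) → Covers (endpoint u c) t → T (isSaturated u (c ∷ʳ t))
isSaturated-∷ʳ⁺ u {t} c sat (a<b , len≡) rewrite isSaturated-++ u c (t ∷ []) =
  Equivalence.from T-∧ (sat , Equivalence.from T-∧ (ℕₚ.<⇒<ᵇ a<b , Equivalence.from T-∧ (fromWitness len≡ , tt)))

IsChainTo : OneLine n → List (Pair n) → Set
IsChainTo w c = T (isSaturated identity c) × endpoint identity c ≡ w

∈-sequences⁺ : {xs : List A} (c : List A) → All (_∈ xs) c → c ∈ sequences xs (length c)
∈-sequences⁺ []      []           = here refl
∈-sequences⁺ {xs = xs} (t ∷ c) (t∈xs ∷ c⊆xs) =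
  ∈-concatMap⁺ (λ x → List.map (x ∷_) (sequences xs (length c)))
    (Any.map (λ where refl → ∈-map⁺ (t ∷_) (∈-sequences⁺ c c⊆xs)) t∈xs)

isSaturated⇒All∈pairs : (u : OneLine n) (c : List (Pair n)) → T (isSaturated u c) → All (_∈ pairs n) c
isSaturated⇒All∈pairs u []      _   = []
isSaturated⇒All∈pairs u (t ∷ c) sat with (a<b , _) , sat′ ← isSaturated-∷⁻ u c sat =
  ∈-pairs⁺ a<b ∷ isSaturated⇒All∈pairs (swap u t) c sat′

∈-chains⁺ : {w : OneLine n} {c : List (Pair n)} → IsChainTo w c → length c ≡ len w → c ∈ chains w
∈-chains⁺ {n} {w} {c} (sat , end≡w) length≡ =
  ∈-filterᵇ⁺ _ {xs = sequences (pairs n) (len w)}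
    (subst (λ k → c ∈ sequences (pairs n) k) length≡ (∈-sequences⁺ c (isSaturated⇒All∈pairs identity c sat)))
    (Equivalence.from T-∧ (sat , fromWitness end≡w))

∈-chains⁻ : {w : OneLine n} {c : List (Pair n)} → c ∈ chains w → IsChainTo w c
∈-chains⁻ {n} {w} c∈ with sat , end≡w ← Equivalence.to T-∧ (proj₂ (∈-filterᵇ⁻ _ {xs = sequences (pairs n) (len w)} c∈)) =
  sat , toWitness end≡w

-- If u(b) < u(a), then (a, b) is an ascent of u t_ab, and swapping it back gives ℓ(u) > ℓ(u t_ab).
cover⇒ascent : (u : OneLine n) → Injective _≡_ _≡_ (Vec.lookup u) →
               {a b : Fin n} → Covers u (a , b) → ⟦ u ⟧ a < ⟦ u ⟧ b
cover⇒ascent {n} u u-inj {a} {b} (a<b , len≡) with ℕₚ.<-cmp (⟦ u ⟧ a) (⟦ u ⟧ b)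
... | tri< ua<ub _ _ = ua<ub
... | tri≈ _ ua≡ub _ = contradiction ua≡ub (⟦⟧-injective u u-inj (toℕ-<⇒≢ a<b))
... | tri> _ _ ub<ua = ⊥-elim (ℕₚ.<-irrefl refl (ℕₚ.<-trans (subst (len u <_) (sym len≡) (ℕₚ.n<1+n (len u)))
                                                     (subst (λ w → len v < len w) (swap-involutive u a≢b) len-v<)))
  where
  a≢b : a ≢ b
  a≢b = toℕ-<⇒≢ a<b
  v : OneLine n
  v = swap u (a , b)
  len-v< : suc (len v) ≤ len (swap v (a , b))
  len-v< = CoverInjection.suc-len≤len-swap v (swap-injective u a≢b u-inj) a<b
             (subst₂ _<_ (sym (⟦⟧-swap-a u a≢b)) (sym (⟦⟧-swap-b u a≢b)) ub<ua)

MinkowskiSum-cover : (u : OneLine (suc m)) → Injective _≡_ _≡_ (Vec.lookup u) →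
                     {t : Pair (suc m)} {α : Monomial m} → Covers u t →
                     MinkowskiSum (basisSegment t ∷ map basisSegment (Inv u)) α →
                     MinkowskiSum (map basisSegment (Inv (swap u t))) α
MinkowskiSum-cover u u-inj cover@(a<b , len≡) α∈ =
  MinkowskiSum-resp-↭ (↭-sym (map⁺ basisSegment (Inv-swap-↭ (ℕₚ.≤-reflexive len≡))))
    (MinkowskiSum-mono (id ∷ widen (Inv u) id) α∈)
  where
  open CoverInjection u u-inj a<b (cover⇒ascent u u-inj cover)
  widen : ∀ ts → ts ⊆ Inv u → Pointwise _⊆_ (map basisSegment ts) (map basisSegment (map ψ ts))
  widen []       _     = []
  widen (t ∷ ts) ts⊆ = basisSegment-mono (proj₂ (ψ-inversion-widens (ts⊆ (here refl)))) ∷ widen ts (ts⊆ ∘ there)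

saturated-MinkowskiSum : (u : OneLine (suc m)) → Injective _≡_ _≡_ (Vec.lookup u) →
                         (c : List (Pair (suc m))) → T (isSaturated u c) → {α β : Monomial m} →
                         MinkowskiSum (map basisSegment (Inv u)) β → MinkowskiSum (map basisSegment c) α →
                         MinkowskiSum (map basisSegment (Inv (endpoint u c))) (β ⊕ α)
saturated-MinkowskiSum u u-inj [] _ {β = β} β∈ refl = subst (MinkowskiSum _) (sym (⊕-identityʳ β)) β∈
saturated-MinkowskiSum u u-inj (t ∷ c) sat {β = β} β∈ (α₁ , α₂ , α₁∈ , α₂∈ , refl)
  with cover@(a<b , _) , sat′ ← isSaturated-∷⁻ u c sat =
  subst (MinkowskiSum _) (trans (⊕-assoc α₁ β α₂) (⊕-left-comm α₁ β α₂))
    (saturated-MinkowskiSum (swap u t) (swap-injective u (toℕ-<⇒≢ a<b) u-inj) c sat′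
      (MinkowskiSum-cover u u-inj cover (α₁ , β , α₁∈ , β∈ , refl)) α₂∈)

chain⇒MinkowskiSum-Inv : {w : OneLine (suc m)} {c : List (Pair (suc m))} {α : Monomial m} → IsChainTo w c →
                         MinkowskiSum (map basisSegment c) α → MinkowskiSum (map basisSegment (Inv w)) α
chain⇒MinkowskiSum-Inv {c = c} {α} (sat , refl) α∈ =
  subst (MinkowskiSum _) (⊕-identityˡ α)
    (saturated-MinkowskiSum identity identity-injective c sat
      (subst (λ ts → MinkowskiSum (map basisSegment ts) zeroVec) (sym Inv-identity) refl) α∈)

IsChainTo-∷ʳ : {v : OneLine n} (c : List (Pair n)) {t : Pair n} →
               IsChainTo v c → Covers v t → IsChainTo (swap v t) (c ∷ʳ t)
IsChainTo-∷ʳ c {t} (sat , refl) cover = isSaturated-∷ʳ⁺ identity c sat cover , endpoint-++ identity c (t ∷ [])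

∃-chain↭Inv : ∀ k (u : OneLine n) → len u ≡ k → Injective _≡_ _≡_ (Vec.lookup u) →
              ∃[ c ] (IsChainTo u c × c ↭ Inv u)
∃-chain↭Inv zero u len≡0 u-inj =
  [] , (tt , sym (noInversions⇒identity u u-inj Inv≡[])) , ↭-reflexive (sym Inv≡[])
  where
  Inv≡[] : Inv u ≡ []
  Inv≡[] = length≡0⇒≡[] len≡0
∃-chain↭Inv {n} (suc k) u len≡ u-inj
  with _ , t∈ ← length≡suc⇒∃∈ len≡
  with s , s-inv , gap ← ∃-adjacentInversion u (∈-Inv⁻ u t∈) = descend s s-inv gap
  where
  descend : ∀ s → IsInversion u s → NothingBetween u (proj₂ s) (proj₁ s) → ∃[ c ] (IsChainTo u c × c ↭ Inv u)
  descend (a , b) ab-inv@(a<b , _) gap =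
    c ∷ʳ (a , b) ,
    subst (λ w → IsChainTo w (c ∷ʳ (a , b))) (swap-involutive u a≢b) (IsChainTo-∷ʳ c chain (a<b , len-u≡)) ,
    ↭-trans (↭-sym (∷↭∷ʳ (a , b) c)) (↭-trans (↭.prep (a , b) c↭) (↭-sym Inv↭))
    where
    a≢b : a ≢ b
    a≢b = toℕ-<⇒≢ a<b
    v : OneLine n
    v = swap u (a , b)
    Inv↭ : Inv u ↭ (a , b) ∷ Inv v
    Inv↭ = Inv-adjacentSwap-↭ u u-inj ab-inv gap
    len-u≡ : len (swap v (a , b)) ≡ suc (len v)
    len-u≡ = trans (cong len (swap-involutive u a≢b)) (↭-length Inv↭)
    IH : ∃[ c ] (IsChainTo v c × c ↭ Inv v)
    IH = ∃-chain↭Inv k v (ℕₚ.suc-injective (trans (sym (↭-length Inv↭)) len≡)) (swap-injective u a≢b u-inj)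
    c : List (Pair n)
    c = proj₁ IH
    chain : IsChainTo v c
    chain = proj₁ (proj₂ IH)
    c↭ : c ↭ Inv v
    c↭ = proj₂ (proj₂ IH)

∃-chain↭Inv-oneLine : (w : Permutation′ n) → ∃[ c ] (c ∈ chains (oneLine w) × c ↭ Inv (oneLine w))
∃-chain↭Inv-oneLine w with c , chain , c↭ ← ∃-chain↭Inv _ (oneLine w) refl (oneLine-injective w) =
  c , ∈-chains⁺ chain (↭-length c↭) , c↭

Positive : Poly m → Set
Positive p = ∀ {t} → t ∈ p → 0ℚ ℚ.< proj₁ t

coeff-nonneg : (p : Poly m) → Positive p → ∀ α → 0ℚ ℚ.≤ coeff p α
coeff-nonneg []            _   α = ℚₚ.≤-refl
coeff-nonneg ((c , β) ∷ p) pos α with Vec-≡-dec _≟_ β α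
... | yes _ = ℚₚ.+-mono-≤ (ℚₚ.<⇒≤ (pos (here refl))) (coeff-nonneg p (pos ∘ there) α)
... | no _  = ℚₚ.+-mono-≤ (ℚₚ.≤-refl {0ℚ}) (coeff-nonneg p (pos ∘ there) α)

coeff-pos : (p : Poly m) → Positive p → ∀ {c α} → (c , α) ∈ p → 0ℚ ℚ.< coeff p α
coeff-pos ((c , β) ∷ p) pos {α = α} cα∈ with Vec-≡-dec _≟_ β α | cα∈
... | yes _   | _          = ℚₚ.+-mono-<-≤ (pos (here refl)) (coeff-nonneg p (pos ∘ there) α)
... | no β≢α | here refl  = contradiction refl β≢α
... | no _   | there cα∈′ = ℚₚ.+-mono-≤-< (ℚₚ.≤-refl {0ℚ}) (coeff-pos p (pos ∘ there) cα∈′)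

coeff-absent : (p : Poly m) (α : Monomial m) → (∀ {c} → (c , α) ∉ p) → coeff p α ≡ 0ℚ
coeff-absent []            α _      = refl
coeff-absent ((c , β) ∷ p) α absent with Vec-≡-dec _≟_ β α
... | yes refl = contradiction (here refl) absent
... | no _     = trans (ℚₚ.+-identityˡ _) (coeff-absent p α (absent ∘ there))

InSupp⇔∃∈ : (p : Poly m) → Positive p → ∀ α → InSupp p α ⇔ (∃[ c ] (c , α) ∈ p)
InSupp⇔∃∈ p pos α = mk⇔ to from
  where
  to : InSupp p α → ∃[ c ] (c , α) ∈ p
  to α∈supp with Any.any? (λ t → Vec-≡-dec _≟_ (proj₂ t) α) p
  ... | yes some with (c , _) , cα∈ , refl ← find some = c , cα∈
  ... | no none  = contradiction (coeff-absent p α λ cα∈ → none (Any.map (λ where refl → refl) cα∈)) α∈supp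
  from : ∃[ c ] (c , α) ∈ p → InSupp p α
  from (_ , cα∈) coeff≡0 = ℚₚ.<-irrefl (sym coeff≡0) (coeff-pos p pos cα∈)

∈-⊗⁻ : (p q : Poly m) {t : ℚ × Monomial m} → t ∈ p ⊗ q →
       ∃[ x ] ∃[ y ] (x ∈ p × y ∈ q × t ≡ (proj₁ x ℚ.* proj₁ y , proj₂ x ⊕ proj₂ y))
∈-⊗⁻ p q t∈ with x , x∈ , t∈x⊗q ← find (∈-concatMap⁻ _ {xs = p} t∈) with y , y∈ , refl ← ∈-map⁻ _ t∈x⊗q =
  x , y , x∈ , y∈ , refl

∈-⊗⁺ : (p q : Poly m) {x y : ℚ × Monomial m} → x ∈ p → y ∈ q →
       (proj₁ x ℚ.* proj₁ y , proj₂ x ⊕ proj₂ y) ∈ p ⊗ q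
∈-⊗⁺ p q x∈ y∈ = ∈-concatMap⁺ _ {xs = p} (Any.map (λ where refl → ∈-map⁺ _ y∈) x∈)

∈-chainWeight⁻ : (c : List (Pair (suc m))) {t : ℚ × Monomial m} → t ∈ chainWeight c →
                 proj₁ t ≡ 1ℚ × MinkowskiSum (map basisSegment c) (proj₂ t)
∈-chainWeight⁻ []      (here refl) = refl , refl
∈-chainWeight⁻ (s ∷ c) t∈
  with x , y , x∈ , y∈ , refl ← ∈-⊗⁻ (edgeWeight s) (chainWeight c) t∈
  with i , i∈ , refl ← ∈-map⁻ _ x∈
  with y≡1 , y∈c ← ∈-chainWeight⁻ c y∈ =
  trans (cong (1ℚ ℚ.*_) y≡1) (ℚₚ.*-identityˡ 1ℚ) , e i , proj₂ y , ∈-map⁺ _ i∈ , y∈c , refl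

∈-chainWeight⁺ : (c : List (Pair (suc m))) {α : Monomial m} →
                 MinkowskiSum (map basisSegment c) α → (1ℚ , α) ∈ chainWeight c
∈-chainWeight⁺ []      refl = here refl
∈-chainWeight⁺ (s ∷ c) (β , γ , β∈ , γ∈ , refl) with i , i∈ , refl ← ∈-map⁻ _ β∈ =
  ∈-⊗⁺ (edgeWeight s) (chainWeight c) (∈-map⁺ _ i∈) (∈-chainWeight⁺ c γ∈)

module _ (w : Permutation′ (suc m)) where

  private
    ℓ! : ℕ
    ℓ! = len (oneLine w) !
    1/ℓ! : ℚ
    1/ℓ! = ℚ._/_ (+ 1) ℓ! {{len (oneLine w) !≢0}}
    1/ℓ!-positive : 0ℚ ℚ.< 1/ℓ!
    1/ℓ!-positive = ℚₚ.positive⁻¹ 1/ℓ! {{ℚₚ.normalize-pos 1 ℓ! {{len (oneLine w) !≢0}}}}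
    weightedChains : Poly m
    weightedChains = concatMap chainWeight (chains (oneLine w))

  -- Projections rather than `with … refl` here: abstracting over a membership in dualSchubert w
  -- makes the checker normalise len (oneLine w), which exhausts memory.
  ∈-dualSchubert⁻ : {t : ℚ × Monomial m} → t ∈ dualSchubert w →
                    0ℚ ℚ.< proj₁ t × ∃[ c ] (c ∈ chains (oneLine w) × MinkowskiSum (map basisSegment c) (proj₂ t))
  ∈-dualSchubert⁻ {t} t∈ =
    subst (λ s → 0ℚ ℚ.< proj₁ s) (sym t≡) (subst (0ℚ ℚ.<_) (sym 1/ℓ!*x≡1/ℓ!) 1/ℓ!-positive) ,
    c , c∈ , subst (MinkowskiSum _) (sym (cong proj₂ t≡)) (proj₂ x-props)
    where
    unscaled : ∃[ x ] (x ∈ weightedChains × t ≡ (1/ℓ! ℚ.* proj₁ x , proj₂ x))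
    unscaled = ∈-map⁻ _ {xs = weightedChains} t∈
    x : ℚ × Monomial m
    x = proj₁ unscaled
    t≡ : t ≡ (1/ℓ! ℚ.* proj₁ x , proj₂ x)
    t≡ = proj₂ (proj₂ unscaled)
    chain : ∃[ c ] (c ∈ chains (oneLine w) × x ∈ chainWeight c)
    chain = find (∈-concatMap⁻ chainWeight {xs = chains (oneLine w)} (proj₁ (proj₂ unscaled)))
    c : List (Pair (suc m))
    c = proj₁ chain
    c∈ : c ∈ chains (oneLine w)
    c∈ = proj₁ (proj₂ chain)
    x-props : proj₁ x ≡ 1ℚ × MinkowskiSum (map basisSegment c) (proj₂ x)
    x-props = ∈-chainWeight⁻ c (proj₂ (proj₂ chain))
    1/ℓ!*x≡1/ℓ! : 1/ℓ! ℚ.* proj₁ x ≡ 1/ℓ!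
    1/ℓ!*x≡1/ℓ! = trans (cong (1/ℓ! ℚ.*_) (proj₁ x-props)) (ℚₚ.*-identityʳ 1/ℓ!)

  ∈-dualSchubert⁺ : {c : List (Pair (suc m))} {α : Monomial m} → c ∈ chains (oneLine w) →
                    MinkowskiSum (map basisSegment c) α → (1/ℓ! ℚ.* 1ℚ , α) ∈ dualSchubert w
  ∈-dualSchubert⁺ {c} c∈ α∈ =
    ∈-map⁺ _ {xs = weightedChains}
      (∈-concatMap⁺ chainWeight {xs = chains (oneLine w)} (Any.map (λ where refl → ∈-chainWeight⁺ c α∈) c∈))

  InSupp-dualSchubert⇔ : (α : Monomial m) →
    InSupp (dualSchubert w) α ⇔ (∃[ c ] (c ∈ chains (oneLine w) × MinkowskiSum (map basisSegment c) α))
  InSupp-dualSchubert⇔ α = ⇔-trans (InSupp⇔∃∈ (dualSchubert w) (proj₁ ∘ ∈-dualSchubert⁻) α)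
    (mk⇔ (λ (_ , dα∈) → proj₂ (∈-dualSchubert⁻ dα∈)) (λ (_ , c∈ , α∈) → _ , ∈-dualSchubert⁺ c∈ α∈))

theorem1p2 : (m : ℕ) (w : Permutation′ (suc m)) (α : Monomial m) →
    InSupp (dualSchubert w) α ⇔ MinkowskiSum (map basisSegment (Inv (oneLine w))) α
theorem1p2 m w α = ⇔-trans (InSupp-dualSchubert⇔ w α) (mk⇔ chain⇒Inv Inv⇒chain)
  where
  chain⇒Inv : ∃[ c ] (c ∈ chains (oneLine w) × MinkowskiSum (map basisSegment c) α) →
              MinkowskiSum (map basisSegment (Inv (oneLine w))) α
  chain⇒Inv (_ , c∈ , α∈) = chain⇒MinkowskiSum-Inv (∈-chains⁻ c∈) α∈
  Inv⇒chain : MinkowskiSum (map basisSegment (Inv (oneLine w))) α →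
              ∃[ c ] (c ∈ chains (oneLine w) × MinkowskiSum (map basisSegment c) α)
  Inv⇒chain α∈ with c , c∈ , c↭Inv ← ∃-chain↭Inv-oneLine w =
    c , c∈ , MinkowskiSum-resp-↭ (map⁺ basisSegment (↭-sym c↭Inv)) α∈
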